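{- Let $d\ge 2$ be an integer and $n=d^2$. Let $C$ be a circle of circumference $n$ with integer points $0,1,\dots,n-1$ in clockwise order. For $0\le i,j<d$ write $(i,j)_d$ for the point $i\cdot d+j$. Let $R$ be the set of all arcs $[(i,j)_d,(j,i)_d]$ with $0\le i,j<d$, $i\ne j$, whose length is at most $n/4$. Then for any two distinct arcs $r=[(i,j)_d,(j,i)_d]$ and $r'=[(i',j')_d,(j',i')_d]$ in $R$, at least one of $r$, $r'$ contains an integral subarc $s$ of length $d-2$ that is disjoint from the other arc.
   Context: For points $a,b$ of the circle, $[a,b]$ denotes the arc starting at $a$ and going clockwise to $b$; its length is $b-a \pmod n$. An arc is integral if both its endpoints are integer points. -}

module Defs where

open import Data.Nat using (ℕ; _+_; _*_; _∸_; _≤_; _<_; _≤?_)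
open import Data.Product using (_×_; Σ-syntax)
open import Relation.Nullary using (¬_; yes; no)
open import Relation.Binary.PropositionalEquality using (_≡_)

-- The circle of circumference n; integer points are 0,1,…,n-1 in clockwise order.
-- An integral arc [a,b] (a,b < n) is represented by its pair of endpoints.

cw : ℕ → ℕ → ℕ → ℕ
cw n a b with a ≤? b
... | yes _ = b ∸ a
... | no  _ = b + n ∸ a

arcLength : ℕ → ℕ → ℕ → ℕ
arcLength n a b = cw n a b

pt : ℕ → ℕ → ℕ → ℕ
pt d i j = i * d + j

_∈Arc[_,_]_ : ℕ → ℕ → ℕ → ℕ → Set
x ∈Arc[ a , b ] n = cw n a x ≤ cw n a b

-- the integral arc [s,t] is a subarc of [a,b] (as point sets, circle of
-- circumference n; valid since the arcs considered have length < n):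
-- s lies on [a,b] at offset cw a s and the arc continues for length cw s t
-- without leaving [a,b].
Subarc : ℕ → ℕ → ℕ → ℕ → ℕ → Set
Subarc n s t a b = cw n a s + cw n s t ≤ cw n a b

-- two closed integral arcs are disjoint (they share no integer point;
-- for closed arcs with integer endpoints this is the same as sharing no point)
Disjoint : ℕ → ℕ → ℕ → ℕ → ℕ → Set
Disjoint n s t a b = ∀ x → x < n → ¬ ((x ∈Arc[ s , t ] n) × (x ∈Arc[ a , b ] n))

InR : ℕ → ℕ → ℕ → Set
InR d i j = 4 * arcLength (d * d) (pt d i j) (pt d j i) ≤ d * d

HasPrivateSubarc : ℕ → ℕ → ℕ → ℕ → ℕ → Set
HasPrivateSubarc d a b a' b' =
  Σ[ s ∈ ℕ ] Σ[ t ∈ ℕ ]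
    (s < d * d) × (t < d * d) × (arcLength (d * d) s t ≡ d ∸ 2)
    × Subarc (d * d) s t a b × Disjoint (d * d) s t a' b'

-- The end of r_{ij} is tied to its start by (i,j)_d · d + i ≡ (j,i)_d (mod d²).  Comparing
-- this relation for two arcs r, r' turns the offsets between their endpoints into base-d
-- digit equations: if r' starts at most d-2 after r and the two ends are at most d-2 apart,
-- the digits force (i,j) = (i',j'); the same comparison of r with itself shows that every
-- arc in R is longer than d-2.  Otherwise a stretch of length d-2 at the start or the end of
-- one arc lies outside the other.  Arcs in R have length at most n/4, so adding offsets
-- never wraps around the circle.
module Submission where

open import Defs
open import Data.Nat using (ℕ; _≤_; _<_; _*_)
open import Data.Product using (_×_; _,_)
open import Data.Sum using (_⊎_)
open import Relation.Binary.PropositionalEquality using (_≡_; _≢_)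

open import Data.Empty using (⊥; ⊥-elim)
open import Data.Nat
  using (zero; suc; _+_; _∸_; _≤?_; _<?_; z≤n; s≤s; NonZero; >-nonZero⁻¹)
open import Data.Nat.DivMod
open import Data.Nat.Properties
open import Data.Nat.Tactic.RingSolver using (solve-∀)
open import Data.Product using (uncurry)
open import Data.Sum using (inj₁; inj₂; swap)
open import Level using (0ℓ)
open import Relation.Binary.Bundles using (Setoid)
open import Relation.Binary.Structures using (IsEquivalence)
open import Relation.Binary.PropositionalEquality
  using (refl; sym; trans; cong; cong₂; subst; module ≡-Reasoning)
import Relation.Binary.Reasoning.Setoid as SetoidReasoning
open import Relation.Nullary using (¬_; Dec; yes; no; contradiction)

+<-of-quarters : ∀ {n x y} .{{_ : NonZero n}} → 4 * x ≤ n → 4 * y ≤ n → x + y < n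
+<-of-quarters {n} {x} {y} 4x≤n 4y≤n = *-cancelˡ-< 4 (x + y) n (begin-strict
  4 * (x + y)   ≡⟨ *-distribˡ-+ 4 x y ⟩
  4 * x + 4 * y ≤⟨ +-mono-≤ 4x≤n 4y≤n ⟩
  n + n         ≡⟨ cong (n +_) (+-identityʳ n) ⟨
  2 * n         <⟨ *-monoˡ-< n {2} {4} (s≤s (s≤s (s≤s z≤n))) ⟩
  4 * n         ∎)
  where open ≤-Reasoning

m+[n+o+p]≡m+p+n+o : ∀ x y z w → x + (y + z + w) ≡ x + w + y + z
m+[n+o+p]≡m+p+n+o = solve-∀

module Modular (n : ℕ) .{{_ : NonZero n}} where

  -- A record rather than a synonym for x % n ≡ y % n, so that x and y can be inferred.
  infix 4 _≋_
  record _≋_ (x y : ℕ) : Set where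
    constructor mod-≡
    field %-≡ : x % n ≡ y % n

  ≋-isEquivalence : IsEquivalence _≋_
  ≋-isEquivalence = record
    { refl  = mod-≡ refl
    ; sym   = λ (mod-≡ p) → mod-≡ (sym p)
    ; trans = λ (mod-≡ p) (mod-≡ q) → mod-≡ (trans p q)
    }

  ≋-setoid : Setoid 0ℓ 0ℓ
  ≋-setoid = record { isEquivalence = ≋-isEquivalence }

  open IsEquivalence ≋-isEquivalence public
    using () renaming (sym to ≋-sym; trans to ≋-trans)

  ≋-reflexive : ∀ {x y} → x ≡ y → x ≋ y
  ≋-reflexive x≡y = mod-≡ (cong (_% n) x≡y)

  ≋-% : ∀ x → x ≋ x % n
  ≋-% x = mod-≡ (sym (m%n%n≡m%n x n))

  ≋⇒≡ : ∀ {x y} → x < n → y < n → x ≋ y → x ≡ y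
  ≋⇒≡ {x} {y} x<n y<n (mod-≡ x%n≡y%n) = begin
    x     ≡⟨ m<n⇒m%n≡m x<n ⟨
    x % n ≡⟨ x%n≡y%n ⟩
    y % n ≡⟨ m<n⇒m%n≡m y<n ⟩
    y     ∎
    where open ≡-Reasoning

  m+kn≋m : ∀ x k → x + k * n ≋ x
  m+kn≋m x k = mod-≡ ([m+kn]%n≡m%n x k n)

  +-congʳ : ∀ z {x y} → x ≋ y → x + z ≋ y + z
  +-congʳ z {x} {y} (mod-≡ x%n≡y%n) = mod-≡ (begin
    (x + z) % n           ≡⟨ %-distribˡ-+ x z n ⟩
    (x % n + z % n) % n   ≡⟨ cong (λ u → (u + z % n) % n) x%n≡y%n ⟩
    (y % n + z % n) % n   ≡⟨ %-distribˡ-+ y z n ⟨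
    (y + z) % n           ∎)
    where open ≡-Reasoning

  *-congʳ : ∀ k {x y} → x ≋ y → x * k ≋ y * k
  *-congʳ k {x} {y} (mod-≡ x%n≡y%n) = mod-≡ (begin
    (x * k) % n           ≡⟨ %-distribˡ-* x k n ⟩
    (x % n * (k % n)) % n ≡⟨ cong (λ u → (u * (k % n)) % n) x%n≡y%n ⟩
    (y % n * (k % n)) % n ≡⟨ %-distribˡ-* y k n ⟨
    (y * k) % n           ∎)
    where open ≡-Reasoning

  m+[n∸m%n]≡[1+m/n]*n : ∀ z → z + (n ∸ z % n) ≡ suc (z / n) * n
  m+[n∸m%n]≡[1+m/n]*n z = begin
    z + (n ∸ z % n)                 ≡⟨ cong (_+ (n ∸ z % n)) (m≡m%n+[m/n]*n z n) ⟩
    z % n + z / n * n + (n ∸ z % n) ≡⟨ rearrange (z % n) (z / n * n) (n ∸ z % n) ⟩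
    z / n * n + (z % n + (n ∸ z % n)) ≡⟨ cong (z / n * n +_) (m+[n∸m]≡n (m%n≤n z n)) ⟩
    z / n * n + n                   ≡⟨ +-comm (z / n * n) n ⟩
    n + z / n * n                   ∎
    where
      open ≡-Reasoning
      rearrange : ∀ r q w → r + q + w ≡ q + (r + w)
      rearrange = solve-∀

  -- Adding n ∸ z % n turns z into a multiple of n, which undoes the addition of z.
  +-cancelˡ : ∀ z {x y} → z + x ≋ z + y → x ≋ y
  +-cancelˡ z {x} {y} z+x≋z+y = begin
    x                      ≈⟨ m+kn≋m x (suc (z / n)) ⟨
    x + suc (z / n) * n    ≡⟨ cong (x +_) (m+[n∸m%n]≡[1+m/n]*n z) ⟨
    x + (z + w)            ≡⟨ rearrange x z w ⟩
    z + x + w              ≈⟨ +-congʳ w z+x≋z+y ⟩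
    z + y + w              ≡⟨ rearrange y z w ⟨
    y + (z + w)            ≡⟨ cong (y +_) (m+[n∸m%n]≡[1+m/n]*n z) ⟩
    y + suc (z / n) * n    ≈⟨ m+kn≋m y (suc (z / n)) ⟩
    y                      ∎
    where
      open SetoidReasoning ≋-setoid
      w : ℕ
      w = n ∸ z % n
      rearrange : ∀ x z w → x + (z + w) ≡ z + x + w
      rearrange = solve-∀

  cw-+ : ∀ {a x} → a < n → a + cw n a x ≋ x
  cw-+ {a} {x} a<n with a ≤? x
  ... | yes a≤x = ≋-reflexive (m+[n∸m]≡n a≤x)
  ... | no _ = ≋-trans (≋-reflexive (m+[n∸m]≡n (≤-trans (<⇒≤ a<n) (m≤n+m n x))))
                       (mod-≡ ([m+n]%n≡m%n x n))

  cw<n : ∀ {a x} → a < n → x < n → cw n a x < n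
  cw<n {a} {x} a<n x<n with a ≤? x
  ... | yes _ = ≤-<-trans (m∸n≤m x a) x<n
  ... | no a≰x = m<n+o⇒m∸n<o (x + n) a (+-monoˡ-< n (≰⇒> a≰x))

  cw-unique : ∀ {a x k} → a < n → x < n → k < n → a + k ≋ x → cw n a x ≡ k
  cw-unique {a} a<n x<n k<n a+k≋x =
    ≋⇒≡ (cw<n a<n x<n) k<n (+-cancelˡ a (≋-trans (cw-+ a<n) (≋-sym a+k≋x)))

  cw-split : ∀ {a y x} → a < n → y < n → x < n → cw n a y + cw n y x < n →
             cw n a x ≡ cw n a y + cw n y x
  cw-split {a} {y} {x} a<n y<n x<n sum<n = cw-unique a<n x<n sum<n (begin
    a + (cw n a y + cw n y x) ≡⟨ +-assoc a (cw n a y) (cw n y x) ⟨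
    a + cw n a y + cw n y x   ≈⟨ +-congʳ (cw n y x) (cw-+ a<n) ⟩
    y + cw n y x              ≈⟨ cw-+ y<n ⟩
    x                         ∎)
    where open SetoidReasoning ≋-setoid

  cw-through : ∀ {a a' b' x} → a < n → a' < n → x < n → cw n a a' + cw n a' b' < n →
               x ∈Arc[ a' , b' ] n → cw n a x ≡ cw n a a' + cw n a' x
  cw-through a<n a'<n x<n lt x∈ = cw-split a<n a'<n x<n (≤-<-trans (+-monoʳ-≤ _ x∈) lt)

  cw+cw≋0 : ∀ {a b} → a < n → b < n → cw n a b + cw n b a ≋ 0
  cw+cw≋0 {a} {b} a<n b<n = +-cancelˡ a (begin
    a + (cw n a b + cw n b a) ≡⟨ +-assoc a (cw n a b) (cw n b a) ⟨
    a + cw n a b + cw n b a   ≈⟨ +-congʳ (cw n b a) (cw-+ a<n) ⟩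
    b + cw n b a              ≈⟨ cw-+ b<n ⟩
    a                         ≡⟨ +-identityʳ a ⟨
    a + 0                     ∎)
    where open SetoidReasoning ≋-setoid

  cw+cw≤n : ∀ {a b} → a < n → b < n → cw n a b + cw n b a ≤ n
  cw+cw≤n {a} {b} a<n b<n = begin
    s                 ≡⟨ m≡m%n+[m/n]*n s n ⟩
    s % n + s / n * n ≡⟨ cong (_+ s / n * n) s%n≡0 ⟩
    s / n * n         ≤⟨ *-monoˡ-≤ n (≤-pred (m<n*o⇒m/o<n {n = 2} {o = n} s<2n)) ⟩
    1 * n             ≡⟨ *-identityˡ n ⟩
    n                 ∎
    where
      open ≤-Reasoning
      s : ℕ
      s = cw n a b + cw n b a
      s%n≡0 : s % n ≡ 0
      s%n≡0 = trans (_≋_.%-≡ (cw+cw≋0 a<n b<n)) (m<n⇒m%n≡m (>-nonZero⁻¹ n))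
      s<2n : s < 2 * n
      s<2n = subst (s <_) (cong (n +_) (sym (+-identityʳ n)))
                   (+-mono-< (cw<n a<n b<n) (cw<n b<n a<n))

module Points (m : ℕ) where

  d : ℕ
  d = suc (suc m)

  n : ℕ
  n = d * d

  open Modular n

  ≤m⇒<d : ∀ {x} → x ≤ m → x < d
  ≤m⇒<d x≤m = s≤s (m≤n⇒m≤1+n x≤m)

  <d⇒<n : ∀ {x} → x < d → x < n
  <d⇒<n x<d = <-≤-trans x<d (m≤m*n d d)

  pt<n : ∀ {i j} → i < d → j < d → pt d i j < n
  pt<n {i} {j} i<d j<d = <-≤-trans (+-monoʳ-< (i * d) j<d)
    (≤-trans (≤-reflexive (+-comm (i * d) d)) (*-monoˡ-≤ d i<d))

  digits<n : ∀ {x y z} → x ≤ m → y < d → z < d → x * d + y + z < n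
  digits<n {x} {y} {z} x≤m y<d z<d = begin-strict
    x * d + y + z      <⟨ +-mono-≤-< (+-mono-≤ (*-monoˡ-≤ d x≤m) (≤-pred y<d)) z<d ⟩
    m * d + suc m + d  ≤⟨ +-monoˡ-≤ d (+-monoʳ-≤ (m * d) (n≤1+n (suc m))) ⟩
    m * d + d + d      ≡⟨ rearrange (m * d) d ⟩
    n                  ∎
    where
      open ≤-Reasoning
      rearrange : ∀ u d → u + d + d ≡ d + (d + u)
      rearrange = solve-∀

  d≤[1+k]*d+y : ∀ k y → d ≤ suc k * d + y
  d≤[1+k]*d+y k y = ≤-trans (m≤m+n d (k * d)) (m≤m+n (suc k * d) y)

  no-carry : ∀ x {y z} → x * d + y ≤ z → z < d → x ≡ 0
  no-carry zero    _  _   = refl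
  no-carry (suc k) le z<d = ⊥-elim (<⇒≱ z<d (≤-trans (d≤[1+k]*d+y k _) le))

  carry≤1 : ∀ x {y z w} → x * d + y ≡ z + w → z < d → w < d → x ≤ 1
  carry≤1 zero                _   _   _   = z≤n
  carry≤1 (suc zero)          _   _   _   = s≤s z≤n
  carry≤1 (suc (suc x)) {y} {z} {w} eq z<d w<d = ⊥-elim (<⇒≱ (+-mono-< z<d w<d) (begin
    d + d                     ≤⟨ +-monoʳ-≤ d (m≤m+n d (x * d)) ⟩
    suc (suc x) * d           ≤⟨ m≤m+n (suc (suc x) * d) y ⟩
    suc (suc x) * d + y       ≡⟨ eq ⟩
    z + w                     ∎))
    where open ≤-Reasoning

  last-digit : ∀ {x} → x < d → d ≤ suc x → x ≡ suc m
  last-digit x<d d≤1+x = ≤-antisym (≤-pred x<d) (≤-pred d≤1+x)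

  overlapping-digits : ∀ {i j i' j' g e} → i < d → j < d → g < d → e < d → i ≢ j →
    g * d + i' ≡ e + i → e * d + j' ≡ g + j → i ≡ i' × j ≡ j'
  overlapping-digits {i' = i'} {j' = j'} {g = g} {e = e} i<d j<d g<d e<d i≢j eq₁ eq₂
    with carry≤1 g eq₁ e<d i<d | carry≤1 e eq₂ g<d j<d
  ... | z≤n     | z≤n     = sym eq₁ , sym eq₂
  ... | z≤n     | s≤s z≤n = contradiction (no-carry 1 (≤-reflexive eq₂) j<d) λ ()
  ... | s≤s z≤n | z≤n     = contradiction (no-carry 1 (≤-reflexive eq₁) i<d) λ ()
  ... | s≤s z≤n | s≤s z≤n = ⊥-elim (i≢j (trans (last-digit i<d (d≤ i' eq₁))
                                              (sym (last-digit j<d (d≤ j' eq₂)))))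
    where
      d≤ : ∀ y {z} → 1 * d + y ≡ z → d ≤ z
      d≤ y eq = ≤-trans (d≤[1+k]*d+y 0 y) (≤-reflexive eq)

  nested-digits : ∀ {i j i' j' g e} → i < d → j' < d →
    g * d + i' + e ≡ i → e * d + j + g ≡ j' → i ≡ i' × j ≡ j'
  nested-digits {j = j} {i' = i'} {g = g} {e = e} i<d j'<d eq₁ eq₂
    with no-carry g (≤-trans (m≤m+n _ e) (≤-reflexive eq₁)) i<d
       | no-carry e (≤-trans (m≤m+n _ g) (≤-reflexive eq₂)) j'<d
  ... | refl | refl = trans (sym eq₁) (+-identityʳ i') , trans (sym (+-identityʳ j)) eq₂

  pt-swap : ∀ i j → pt d i j * d + i ≋ pt d j i
  pt-swap i j = ≋-trans (≋-reflexive (rearrange i j d)) (m+kn≋m (pt d j i) i)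
    where
      rearrange : ∀ i j d → (i * d + j) * d + i ≡ (j * d + i) + i * (d * d)
      rearrange = solve-∀

  pt-shift : ∀ i j i' j' {k} → pt d i j + k ≋ pt d i' j' →
             pt d j i + k * d + i' ≋ pt d j' i' + i
  pt-shift i j i' j' {k} shift = begin
    pt d j i + k * d + i'                ≈⟨ +-congʳ i' (+-congʳ (k * d) (pt-swap i j)) ⟨
    pt d i j * d + i + k * d + i'        ≡⟨ rearrange (pt d i j) k d i i' ⟩
    (pt d i j + k) * d + i' + i          ≈⟨ +-congʳ i (+-congʳ i' (*-congʳ d shift)) ⟩
    pt d i' j' * d + i' + i              ≈⟨ +-congʳ i (pt-swap i' j') ⟩
    pt d j' i' + i                       ∎
    where
      open SetoidReasoning ≋-setoid
      rearrange : ∀ p k d i i' → p * d + i + k * d + i' ≡ (p + k) * d + i' + i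
      rearrange = solve-∀

  m<cw-pt : ∀ {i j} → i < d → j < d → i ≢ j → m < cw n (pt d i j) (pt d j i)
  m<cw-pt {i} {j} i<d j<d i≢j with m <? cw n (pt d i j) (pt d j i)
  ... | yes m<L = m<L
  ... | no m≮L = ⊥-elim (i≢j (short-arc-digits L
                   (≋⇒≡ (digits<n (≮⇒≥ m≮L) j<d (≤m⇒<d (≮⇒≥ m≮L))) (<d⇒<n i<d) digits≋i)))
    where
      a b L : ℕ
      a = pt d i j
      b = pt d j i
      L = cw n a b
      digits≋i : L * d + j + L ≋ i
      digits≋i = +-cancelˡ a (begin
        a + (L * d + j + L)  ≡⟨ m+[n+o+p]≡m+p+n+o a (L * d) j L ⟩
        a + L + L * d + j    ≈⟨ +-congʳ j (+-congʳ (L * d) (cw-+ (pt<n i<d j<d))) ⟩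
        b + L * d + j        ≈⟨ pt-shift i j j i (cw-+ (pt<n i<d j<d)) ⟩
        a + i                ∎)
        where open SetoidReasoning ≋-setoid
      short-arc-digits : ∀ k → k * d + j + k ≡ i → i ≡ j
      short-arc-digits k eq with no-carry k (≤-trans (m≤m+n _ k) (≤-reflexive eq)) i<d
      ... | refl = trans (sym eq) (+-identityʳ j)

  private-subarc-at : ∀ {a b a' b'} o → a < n → b < n → o + m ≤ cw n a b →
    (∀ x → x < n → o ≤ cw n a x → cw n a x ≤ o + m → ¬ x ∈Arc[ a' , b' ] n) →
    HasPrivateSubarc d a b a' b'
  private-subarc-at {a} {b} {a'} {b'} o a<n b<n o+m≤L outside =
    s , t , s<n , t<n , cw[s,t]≡m ,
    subst (_≤ cw n a b) (sym (cong₂ _+_ cw[a,s]≡o cw[s,t]≡m)) o+m≤L ,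
    disjoint
    where
      s t : ℕ
      s = (a + o) % n
      t = (a + (o + m)) % n
      s<n : s < n
      s<n = m%n<n (a + o) n
      t<n : t < n
      t<n = m%n<n (a + (o + m)) n
      o+m<n : o + m < n
      o+m<n = ≤-<-trans o+m≤L (cw<n a<n b<n)
      cw[a,s]≡o : cw n a s ≡ o
      cw[a,s]≡o = cw-unique a<n s<n (≤-<-trans (m≤m+n o m) o+m<n) (≋-% (a + o))
      cw[s,t]≡m : cw n s t ≡ m
      cw[s,t]≡m = cw-unique s<n t<n (≤-<-trans (m≤n+m m o) o+m<n) (begin
        s + m         ≈⟨ +-congʳ m (≋-% (a + o)) ⟨
        a + o + m     ≡⟨ +-assoc a o m ⟩
        a + (o + m)   ≈⟨ ≋-% (a + (o + m)) ⟩
        t             ∎)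
        where open SetoidReasoning ≋-setoid
      disjoint : Disjoint n s t a' b'
      disjoint x x<n (x∈[s,t] , x∈[a',b']) =
        outside x x<n (subst (o ≤_) (sym cw[a,x]≡o+) (m≤m+n o _))
                      (subst (_≤ o + m) (sym cw[a,x]≡o+) (+-monoʳ-≤ o cw[s,x]≤m))
                      x∈[a',b']
        where
          cw[s,x]≤m : cw n s x ≤ m
          cw[s,x]≤m = subst (cw n s x ≤_) cw[s,t]≡m x∈[s,t]
          cw[a,x]≡o+ : cw n a x ≡ o + cw n s x
          cw[a,x]≡o+ = trans
            (cw-split a<n s<n x<n (subst (λ u → u + cw n s x < n) (sym cw[a,s]≡o)
                                         (≤-<-trans (+-monoʳ-≤ o cw[s,x]≤m) o+m<n)))
            (cong (_+ cw n s x) cw[a,s]≡o)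

  initial-segment-private : ∀ {a b a' b'} → a < n → b < n → a' < n →
    m ≤ cw n a b → m < cw n a a' → cw n a a' + cw n a' b' < n →
    HasPrivateSubarc d a b a' b'
  initial-segment-private {a} {b} {a'} {b'} a<n b<n a'<n m≤L m<g g+L'<n =
    private-subarc-at {a' = a'} {b' = b'} 0 a<n b<n m≤L λ x x<n _ x≤m x∈r' →
      <⇒≱ m<g (≤-trans (≤-trans (m≤m+n (cw n a a') _)
                                (≤-reflexive (sym (cw-through a<n a'<n x<n g+L'<n x∈r'))))
                       x≤m)

  final-segment-private : ∀ {a b a' b'} → a < n → b < n → a' < n → m ≤ cw n a b →
    cw n a a' + cw n a' b' + m < cw n a b → cw n a a' + cw n a' b' < n →
    HasPrivateSubarc d a b a' b'
  final-segment-private {a} {b} {a'} {b'} a<n b<n a'<n m≤L P+m<L P<n =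
    private-subarc-at {a' = a'} {b' = b'} (L ∸ m) a<n b<n (≤-reflexive (m∸n+n≡m m≤L))
      λ x x<n L∸m≤ _ x∈r' →
        <⇒≱ P+m<L (begin
          L                             ≡⟨ m∸n+n≡m m≤L ⟨
          L ∸ m + m                     ≤⟨ +-monoˡ-≤ m L∸m≤ ⟩
          cw n a x + m                  ≡⟨ cong (_+ m) (cw-through a<n a'<n x<n P<n x∈r') ⟩
          cw n a a' + cw n a' x + m     ≤⟨ +-monoˡ-≤ m (+-monoʳ-≤ (cw n a a') x∈r') ⟩
          cw n a a' + cw n a' b' + m    ∎)
    where
      open ≤-Reasoning
      L : ℕ
      L = cw n a b

  final-segment-private-overhang : ∀ {a b a' b'} → a < n → a' < n → b' < n →
    m ≤ cw n a' b' → cw n a b + m < cw n a a' + cw n a' b' → cw n a a' + cw n a' b' < n →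
    HasPrivateSubarc d a' b' a b
  final-segment-private-overhang {a} {b} {a'} {b'} a<n a'<n b'<n m≤L' L+m<P P<n =
    private-subarc-at {a' = a} {b' = b} (L' ∸ m) a'<n b'<n (≤-reflexive (m∸n+n≡m m≤L'))
      λ x x<n L'∸m≤ ≤L' x∈r →
        <⇒≱ L+m<P (begin
          cw n a a' + L'                ≡⟨ cong (cw n a a' +_) (m∸n+n≡m m≤L') ⟨
          cw n a a' + (L' ∸ m + m)      ≡⟨ +-assoc (cw n a a') (L' ∸ m) m ⟨
          cw n a a' + (L' ∸ m) + m      ≤⟨ +-monoˡ-≤ m (+-monoʳ-≤ (cw n a a') L'∸m≤) ⟩
          cw n a a' + cw n a' x + m     ≡⟨ cong (_+ m) (cw-through a<n a'<n x<n P<n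
                                             (subst (cw n a' x ≤_) (m∸n+n≡m m≤L') ≤L')) ⟨
          cw n a x + m                  ≤⟨ +-monoˡ-≤ m x∈r ⟩
          cw n a b + m                  ∎)
    where
      open ≤-Reasoning
      L' : ℕ
      L' = cw n a' b'

  module ArcPair {i j i' j'} (i<d : i < d) (j<d : j < d) (i'<d : i' < d) (j'<d : j' < d)
                 (i≢j : i ≢ j) (i'≢j' : i' ≢ j') (r : InR d i j) (r' : InR d i' j')
                 (ij≢i'j' : (i , j) ≢ (i' , j')) where

    a b a' b' L L' g : ℕ
    a  = pt d i j
    b  = pt d j i
    a' = pt d i' j'
    b' = pt d j' i'
    L  = cw n a b
    L' = cw n a' b'
    g  = cw n a a'

    a<n : a < n
    a<n = pt<n i<d j<d

    b<n : b < n
    b<n = pt<n j<d i<d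

    a'<n : a' < n
    a'<n = pt<n i'<d j'<d

    b'<n : b' < n
    b'<n = pt<n j'<d i'<d

    L+L'<n : L + L' < n
    L+L'<n = +<-of-quarters {x = L} {y = L'} r r'

    a+P≋b' : a + (g + L') ≋ b'
    a+P≋b' = begin
      a + (g + L') ≡⟨ +-assoc a g L' ⟨
      a + g + L'   ≈⟨ +-congʳ L' (cw-+ a<n) ⟩
      a' + L'      ≈⟨ cw-+ a'<n ⟩
      b'           ∎
      where open SetoidReasoning ≋-setoid

    overlap-impossible : ∀ e → L + e ≡ g + L' → e ≤ m → g ≤ m → ⊥
    overlap-impossible e L+e≡P e≤m g≤m = ij≢i'j' (uncurry (cong₂ _,_)
      (overlapping-digits {g = g} {e = e} i<d j<d (≤m⇒<d g≤m) (≤m⇒<d e≤m) i≢j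
        (≋⇒≡ (≤-<-trans (m≤m+n _ 0) (digits<n g≤m i'<d (s≤s z≤n)))
             (digits<n {0} z≤n (≤m⇒<d e≤m) i<d) digits₁)
        (≋⇒≡ (≤-<-trans (m≤m+n _ 0) (digits<n e≤m j'<d (s≤s z≤n)))
             (digits<n {0} z≤n (≤m⇒<d g≤m) j<d) digits₂)))
      where
        open SetoidReasoning ≋-setoid
        b+e≋b' : b + e ≋ b'
        b+e≋b' = begin
          b + e        ≈⟨ +-congʳ e (cw-+ a<n) ⟨
          a + L + e    ≡⟨ +-assoc a L e ⟩
          a + (L + e)  ≡⟨ cong (a +_) L+e≡P ⟩
          a + (g + L') ≈⟨ a+P≋b' ⟩
          b'           ∎
        digits₁ : g * d + i' ≋ e + i
        digits₁ = +-cancelˡ b (begin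
          b + (g * d + i') ≡⟨ +-assoc b (g * d) i' ⟨
          b + g * d + i'   ≈⟨ pt-shift i j i' j' (cw-+ a<n) ⟩
          b' + i           ≈⟨ +-congʳ i b+e≋b' ⟨
          b + e + i        ≡⟨ +-assoc b e i ⟩
          b + (e + i)      ∎)
        digits₂ : e * d + j' ≋ g + j
        digits₂ = +-cancelˡ a (begin
          a + (e * d + j') ≡⟨ +-assoc a (e * d) j' ⟨
          a + e * d + j'   ≈⟨ pt-shift j i j' i' b+e≋b' ⟩
          a' + j           ≈⟨ +-congʳ j (cw-+ a<n) ⟨
          a + g + j        ≡⟨ +-assoc a g j ⟩
          a + (g + j)      ∎)

    nested-impossible : ∀ e → g + L' + e ≡ L → e ≤ m → g ≤ m → ⊥
    nested-impossible e P+e≡L e≤m g≤m = ij≢i'j' (uncurry (cong₂ _,_)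
      (nested-digits {g = g} {e = e} i<d j'<d
        (≋⇒≡ (digits<n g≤m i'<d (≤m⇒<d e≤m)) (<d⇒<n i<d) digits₁)
        (≋⇒≡ (digits<n e≤m j<d (≤m⇒<d g≤m)) (<d⇒<n j'<d) digits₂)))
      where
        open SetoidReasoning ≋-setoid
        b'+e≋b : b' + e ≋ b
        b'+e≋b = begin
          b' + e           ≈⟨ +-congʳ e a+P≋b' ⟨
          a + (g + L') + e ≡⟨ +-assoc a (g + L') e ⟩
          a + (g + L' + e) ≡⟨ cong (a +_) P+e≡L ⟩
          a + L            ≈⟨ cw-+ a<n ⟩
          b                ∎
        digits₁ : g * d + i' + e ≋ i
        digits₁ = +-cancelˡ b' (begin
          b' + (g * d + i' + e) ≡⟨ m+[n+o+p]≡m+p+n+o b' (g * d) i' e ⟩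
          b' + e + g * d + i'   ≈⟨ +-congʳ i' (+-congʳ (g * d) b'+e≋b) ⟩
          b + g * d + i'        ≈⟨ pt-shift i j i' j' (cw-+ a<n) ⟩
          b' + i                ∎)
        digits₂ : e * d + j + g ≋ j'
        digits₂ = +-cancelˡ a (begin
          a + (e * d + j + g) ≡⟨ m+[n+o+p]≡m+p+n+o a (e * d) j g ⟩
          a + g + e * d + j   ≈⟨ +-congʳ j (+-congʳ (e * d) (cw-+ a<n)) ⟩
          a' + e * d + j      ≈⟨ pt-shift j' i' j i b'+e≋b ⟩
          a + j'              ∎)

    ends-close-impossible : g ≤ m → g + L' ≤ L + m → L ≤ g + L' + m → ⊥
    ends-close-impossible g≤m P≤L+m L≤P+m with ≤-total L (g + L')
    ... | inj₁ L≤P = overlap-impossible (g + L' ∸ L) (m+[n∸m]≡n L≤P)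
          (+-cancelˡ-≤ L _ m (≤-trans (≤-reflexive (m+[n∸m]≡n L≤P)) P≤L+m)) g≤m
    ... | inj₂ P≤L = nested-impossible (L ∸ (g + L')) (m+[n∸m]≡n P≤L)
          (+-cancelˡ-≤ (g + L') _ m (≤-trans (≤-reflexive (m+[n∸m]≡n P≤L)) L≤P+m)) g≤m

    m<L : m < L
    m<L = m<cw-pt i<d j<d i≢j

    m<L' : m < L'
    m<L' = m<cw-pt i'<d j'<d i'≢j'

    g≤L⇒g+L'<n : g ≤ L → g + L' < n
    g≤L⇒g+L'<n g≤L = ≤-<-trans (+-monoˡ-≤ L' g≤L) L+L'<n

    private-subarc-if-start-inside : g ≤ L →
      HasPrivateSubarc d a b a' b' ⊎ HasPrivateSubarc d a' b' a b
    private-subarc-if-start-inside g≤L with m <? g | g + L' + m <? L | L + m <? g + L'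
    ... | yes m<g | _          | _          =
      inj₁ (initial-segment-private a<n b<n a'<n (<⇒≤ m<L) m<g (g≤L⇒g+L'<n g≤L))
    ... | no _    | yes P+m<L  | _          =
      inj₁ (final-segment-private a<n b<n a'<n (<⇒≤ m<L) P+m<L (g≤L⇒g+L'<n g≤L))
    ... | no _    | no _       | yes L+m<P  =
      inj₂ (final-segment-private-overhang a<n a'<n b'<n (<⇒≤ m<L') L+m<P (g≤L⇒g+L'<n g≤L))
    ... | no m≮g  | no P+m≮L   | no L+m≮P   =
      ⊥-elim (ends-close-impossible (≮⇒≥ m≮g) (≮⇒≥ L+m≮P) (≮⇒≥ P+m≮L))

    private-subarc-if-starts-outside : L < g → L' < cw n a' a → HasPrivateSubarc d a b a' b'
    private-subarc-if-starts-outside L<g L'<g' =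
      initial-segment-private a<n b<n a'<n (<⇒≤ m<L) (<-trans m<L L<g)
        (<-≤-trans (+-monoʳ-< g L'<g') (cw+cw≤n a<n a'<n))

  private-subarc : ∀ i j i' j' → i < d → j < d → i' < d → j' < d → i ≢ j → i' ≢ j' →
    InR d i j → InR d i' j' → (i , j) ≢ (i' , j') →
    HasPrivateSubarc d (pt d i j) (pt d j i) (pt d i' j') (pt d j' i')
    ⊎ HasPrivateSubarc d (pt d i' j') (pt d j' i') (pt d i j) (pt d j i)
  private-subarc i j i' j' i<d j<d i'<d j'<d i≢j i'≢j' r r' ij≢i'j' =
    by-cases (P.g ≤? P.L) (Q.g ≤? Q.L)
    where
      module P = ArcPair i<d j<d i'<d j'<d i≢j i'≢j' r r' ij≢i'j'
      module Q = ArcPair i'<d j'<d i<d j<d i'≢j' i≢j r' r (λ eq → ij≢i'j' (sym eq))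
      by-cases : Dec (P.g ≤ P.L) → Dec (Q.g ≤ Q.L) →
        HasPrivateSubarc d P.a P.b P.a' P.b' ⊎ HasPrivateSubarc d P.a' P.b' P.a P.b
      by-cases (yes g≤L) _           = P.private-subarc-if-start-inside g≤L
      by-cases (no _)    (yes g'≤L') = swap (Q.private-subarc-if-start-inside g'≤L')
      by-cases (no g≰L)  (no g'≰L')  =
        inj₁ (P.private-subarc-if-starts-outside (≰⇒> g≰L) (≰⇒> g'≰L'))

lemma3 : (d : ℕ) → 2 ≤ d → (i j i' j' : ℕ)
         → i < d → j < d → i' < d → j' < d → i ≢ j → i' ≢ j'
         → InR d i j → InR d i' j'
         → (i , j) ≢ (i' , j')
         → HasPrivateSubarc d (pt d i j) (pt d j i) (pt d i' j') (pt d j' i')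
           ⊎ HasPrivateSubarc d (pt d i' j') (pt d j' i') (pt d i j) (pt d j i)
lemma3 (suc (suc m)) _ = Points.private-subarc m
lemma3 (suc zero) (s≤s ())
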